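{- Let $\mathbb F$ be an arbitrary field and let $W$ be an $n$-dimensional vector space over $\mathbb F$. Let $U_1,\ldots,U_m$ and $V_1,\ldots,V_m$ be subspaces of $W$ such that (i) $U_i\cap V_i=\{0\}$ for each $1\le i\le m$, and (ii) $U_i\cap V_j\neq\{0\}$ whenever $1\le i<j\le m$. Then $m\le 2^n$. -}

module Defs where

open import Level using (Level; _⊔_; suc)
open import Algebra.Bundles using (CommutativeRing)
open import Data.Fin using (Fin)
open import Data.Product using (Σ; ∃; _×_; _,_)
open import Relation.Nullary using (¬_)

record Field (c ℓ : Level) : Set (suc (c ⊔ ℓ)) where
  field
    commutativeRing : CommutativeRing c ℓ
  open CommutativeRing commutativeRing public
  field
    0≉1     : ¬ (0# ≈ 1#)
    inverse : ∀ x → ¬ (x ≈ 0#) → Σ Carrier λ y → (x * y) ≈ 1#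

module _ {c ℓ : Level} (F : Field c ℓ) where
  open Field F

  Vec𝔽 : (n : _) → Set c
  Vec𝔽 n = Fin n → Carrier

  _≈ᵥ_ : ∀ {n} → Vec𝔽 n → Vec𝔽 n → Set ℓ
  u ≈ᵥ v = ∀ i → u i ≈ v i

  0ᵥ : ∀ {n} → Vec𝔽 n
  0ᵥ _ = 0#

  _+ᵥ_ : ∀ {n} → Vec𝔽 n → Vec𝔽 n → Vec𝔽 n
  (u +ᵥ v) i = u i + v i

  _·ᵥ_ : ∀ {n} → Carrier → Vec𝔽 n → Vec𝔽 n
  (a ·ᵥ v) i = a * v i

  record Subspace (n : _) (p : Level) : Set (c ⊔ ℓ ⊔ suc p) where
    field
      _∋_     : Vec𝔽 n → Set p
      resp    : ∀ {u v} → u ≈ᵥ v → _∋_ u → _∋_ v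
      ∋-zero  : _∋_ 0ᵥ
      ∋-+     : ∀ {u v} → _∋_ u → _∋_ v → _∋_ (u +ᵥ v)
      ∋-·     : ∀ a {v} → _∋_ v → _∋_ (a ·ᵥ v)

  open Subspace public

  TrivialIntersection : ∀ {n p} → Subspace n p → Subspace n p → Set (c ⊔ ℓ ⊔ p)
  TrivialIntersection U V = ∀ v → U ∋ v → V ∋ v → v ≈ᵥ 0ᵥ

  NontrivialIntersection : ∀ {n p} → Subspace n p → Subspace n p → Set (c ⊔ ℓ ⊔ p)
  NontrivialIntersection U V = Σ (Vec𝔽 _) λ v → (U ∋ v) × (V ∋ v) × ¬ (v ≈ᵥ 0ᵥ)

-- Work in the exterior algebra Λ(Fⁿ), of dimension 2ⁿ, where a list of vectors wedges to 0
-- exactly when it is linearly dependent. Let αᵢ ⊆ Uᵢ span the chosen nonzero vectors of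
-- Uᵢ ∩ Vⱼ (j > i) and βⱼ ⊆ Vⱼ span those of Uᵢ ∩ Vⱼ (i < j), both lists independent.
-- As Uᵢ ∩ Vᵢ = 0, βᵢ ++ αᵢ is independent, so ⋀(βᵢ ++ αᵢ) ≠ 0; for i < j the spans of αᵢ and
-- βⱼ share a nonzero witness, so ⋀(βⱼ ++ αᵢ) = 0. Hence a nonzero coordinate of βⱼ ∧ (−)
-- is a linear form φⱼ with φᵢ(⋀αᵢ) ≠ 0 and φⱼ(⋀αᵢ) = 0 for i < j: the m elements ⋀αᵢ are
-- independent in Λ(Fⁿ), so m ≤ 2ⁿ.
-- Choosing bases and nonzero coordinates needs excluded middle, so these steps run under ¬¬,
-- which is discharged at the end because m ≤ 2ⁿ is decidable.
module Submission where

open import Level using (Level; _⊔_)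
open import Function using (_∘_; case_of_)
open import Data.Empty using (⊥-elim)
open import Data.Unit using (⊤; tt)
open import Data.Product using (∃; ∃₂; _×_; _,_; proj₁; proj₂)
open import Data.Sum using (_⊎_; inj₁; inj₂; [_,_]′)
open import Data.Nat as ℕ using (ℕ; zero; suc; _≤_; _^_)
import Data.Nat.Properties as ℕ
open import Data.Fin as Fin using (Fin; zero; suc; _<_; combine; remQuot)
import Data.Fin.Properties as Fin
open import Data.List using (List; []; _∷_; _++_; length; map; tabulate)
import Data.List.Properties as List
open import Data.List.Relation.Unary.All as All using (All; []; _∷_)
import Data.List.Relation.Unary.All.Properties as All
open import Data.List.Relation.Unary.All.Properties using (Any¬⇒¬All; tabulate⁺; tabulate⁻)
open import Data.List.Relation.Unary.Any as Any using (Any; here; there)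
import Data.List.Relation.Unary.Any.Properties as Any
open import Data.List.Membership.Propositional using (_∈_; find)
open import Data.List.Membership.Propositional.Properties using (∈-∃++)
open import Data.Vec.Functional using (head; tail)
open import Relation.Binary.PropositionalEquality as ≡ using (_≡_; _≢_)
open import Relation.Nullary using (¬_; Dec; yes; no; contradiction)
open import Relation.Nullary.Negation using (¬¬-map; negated-stable)
open import Relation.Nullary.Decidable using (decidable-stable; ¬¬-excluded-middle)

open import Defs

private
  variable
    ℓ₁ ℓ₂ ℓ₃ : Level
    A : Set ℓ₁
    B : Set ℓ₂

infixl 1 _>>=_

return : A → ¬ ¬ A
return x ¬x = ¬x x

_>>=_ : ¬ ¬ A → (A → ¬ ¬ B) → ¬ ¬ B
(¬¬x >>= f) ¬y = ¬¬x λ x → f x ¬y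

¬¬-pull-Fin : ∀ {m} {P : Fin m → Set ℓ₃} → (∀ i → ¬ ¬ P i) → ¬ ¬ (∀ i → P i)
¬¬-pull-Fin {m = zero} _ = return λ ()
¬¬-pull-Fin {m = suc m} f =
  f zero >>= λ p₀ → ¬¬-pull-Fin (f ∘ suc) >>= λ ps → return λ { zero → p₀ ; (suc i) → ps i }

¬¬-pull-→ : (A → ¬ ¬ B) → ¬ ¬ (A → B)
¬¬-pull-→ f ¬g = ¬g λ x → ⊥-elim (f x λ y → ¬g λ _ → y)

¬¬-¬All⇒Any¬ : {P : A → Set ℓ₃} (xs : List A) → ¬ All P xs → ¬ ¬ Any (¬_ ∘ P) xs
¬¬-¬All⇒Any¬ [] ¬all = contradiction [] ¬all
¬¬-¬All⇒Any¬ (x ∷ xs) ¬all = ¬¬-excluded-middle >>= λ where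
  (yes px) → ¬¬-map there (¬¬-¬All⇒Any¬ xs (¬all ∘ (px ∷_)))
  (no ¬px) → return (here ¬px)

¬¬-¬All⇒split : {P : A → Set ℓ₃} (xs : List A) → ¬ All P xs →
  ¬ ¬ ∃₂ λ ys zs → ∃ λ x → xs ≡ ys ++ x ∷ zs × ¬ P x
¬¬-¬All⇒split xs ¬all = ¬¬-map
  (λ any → let x , x∈xs , ¬px = find any ; ys , zs , eq = ∈-∃++ x∈xs in ys , zs , x , eq , ¬px)
  (¬¬-¬All⇒Any¬ xs ¬all)

split-++ : (xs ys : List A) (zs : List B) → length zs ≡ length xs ℕ.+ length ys →
  ∃₂ λ zs₁ zs₂ → zs ≡ zs₁ ++ zs₂ × length zs₁ ≡ length xs × length zs₂ ≡ length ys
split-++ [] ys zs len = [] , zs , ≡.refl , ≡.refl , len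
split-++ (x ∷ xs) ys (z ∷ zs) len =
  let zs₁ , zs₂ , eq , len₁ , len₂ = split-++ xs ys zs (ℕ.suc-injective len)
  in z ∷ zs₁ , zs₂ , ≡.cong (z ∷_) eq , ≡.cong suc len₁ , len₂

-- A coordinate of Λ n is a subset of Fin n, given by deciding membership of the first
-- index (inj₂ = member) and then recursing.
Coord : ℕ → Set
Coord zero = ⊤
Coord (suc n) = Coord n ⊎ Coord n

size : ∀ {n} → Coord n → ℕ
size {zero} tt = 0
size {suc n} (inj₁ c) = size c
size {suc n} (inj₂ c) = suc (size c)

size≤n : ∀ {n} (c : Coord n) → size c ≤ n
size≤n {zero} tt = ℕ.z≤n
size≤n {suc n} (inj₁ c) = ℕ.m≤n⇒m≤1+n (size≤n c)
size≤n {suc n} (inj₂ c) = ℕ.s≤s (size≤n c)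

decode : ∀ n → Fin (2 ^ n) → Coord n
decode-pair : ∀ n → Fin 2 × Fin (2 ^ n) → Coord (suc n)

decode zero _ = tt
decode (suc n) i = decode-pair n (remQuot (2 ^ n) i)

decode-pair n (zero , j) = inj₁ (decode n j)
decode-pair n (suc _ , j) = inj₂ (decode n j)

encode : ∀ n → Coord n → Fin (2 ^ n)
encode zero tt = zero
encode (suc n) (inj₁ c) = combine {2} zero (encode n c)
encode (suc n) (inj₂ c) = combine {2} (suc zero) (encode n c)

decode-encode : ∀ n (c : Coord n) → decode n (encode n c) ≡ c
decode-encode zero tt = ≡.refl
decode-encode (suc n) (inj₁ c) = ≡.trans
  (≡.cong (decode-pair n) (Fin.remQuot-combine {2} zero (encode n c)))
  (≡.cong inj₁ (decode-encode n c))
decode-encode (suc n) (inj₂ c) = ≡.trans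
  (≡.cong (decode-pair n) (Fin.remQuot-combine {2} (suc zero) (encode n c)))
  (≡.cong inj₂ (decode-encode n c))

module LinearAlgebra {c ℓ : Level} (F : Field c ℓ) where

  open Field F hiding (zero)
  open import Algebra.Properties.Ring ring
    using (-‿distribˡ-*; -‿distribʳ-*; -‿involutive; -1*x≈-x; x[y-z]≈xy-xz)
  open import Algebra.Properties.Group +-group using (inverseˡ-unique; ε⁻¹≈ε)
  open import Algebra.Properties.AbelianGroup +-abelianGroup using (⁻¹-∙-comm; ⁻¹-anti-homo‿-; xyx⁻¹≈y)
  open import Algebra.Properties.CommutativeSemigroup +-commutativeSemigroup
    using (interchange) renaming (x∙yz≈y∙xz to x+[y+z]≈y+[x+z])
  open import Algebra.Properties.CommutativeSemigroup *-commutativeSemigroup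
    using () renaming (x∙yz≈y∙xz to x[yz]≈y[xz])
  open import Relation.Binary.Reasoning.Setoid setoid

  private
    variable
      i : Level
      I : Set i
      n : ℕ

  x≈0⇒x+y≈y : ∀ {x y} → x ≈ 0# → x + y ≈ y
  x≈0⇒x+y≈y {y = y} x≈0 = trans (+-congʳ x≈0) (+-identityˡ y)

  x≈0⇒xy+z≈z : ∀ {x y z} → x ≈ 0# → x * y + z ≈ z
  x≈0⇒xy+z≈z x≈0 = x≈0⇒x+y≈y (trans (*-congʳ x≈0) (zeroˡ _))

  -x≈0 : ∀ {x} → x ≈ 0# → - x ≈ 0#
  -x≈0 x≈0 = trans (-‿cong x≈0) ε⁻¹≈ε

  x-y≈0 : ∀ {x y} → x ≈ 0# → y ≈ 0# → x - y ≈ 0#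
  x-y≈0 x≈0 y≈0 = trans (+-cong x≈0 (-x≈0 y≈0)) (+-identityʳ 0#)

  x-0≈x : ∀ {x} → x - 0# ≈ x
  x-0≈x = trans (+-congˡ ε⁻¹≈ε) (+-identityʳ _)

  x+y≈0⇒x≈-y : ∀ {x y} → x + y ≈ 0# → x ≈ - y
  x+y≈0⇒x≈-y = inverseˡ-unique _ _

  -x≉0 : ∀ {x} → x ≉ 0# → - x ≉ 0#
  -x≉0 {x} x≉0 -x≈0′ = x≉0 (trans (sym (-‿involutive x)) (-x≈0 -x≈0′))

  ax+b≈0⇒x≈-a⁻¹b : ∀ {a a⁻¹ x b} → a * a⁻¹ ≈ 1# → a * x + b ≈ 0# → x ≈ (- a⁻¹) * b
  ax+b≈0⇒x≈-a⁻¹b {a} {a⁻¹} {x} {b} aa⁻¹≈1 ax+b≈0 = begin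
    x              ≈⟨ *-identityˡ x ⟨
    1# * x         ≈⟨ *-congʳ (trans (*-comm a⁻¹ a) aa⁻¹≈1) ⟨
    (a⁻¹ * a) * x  ≈⟨ *-assoc a⁻¹ a x ⟩
    a⁻¹ * (a * x)  ≈⟨ *-congˡ (x+y≈0⇒x≈-y ax+b≈0) ⟩
    a⁻¹ * (- b)    ≈⟨ -‿distribʳ-* a⁻¹ b ⟨
    - (a⁻¹ * b)    ≈⟨ -‿distribˡ-* a⁻¹ b ⟩
    (- a⁻¹) * b    ∎

  xy≈0⇒y≈0 : ∀ {x y} → x ≉ 0# → x * y ≈ 0# → y ≈ 0#
  xy≈0⇒y≈0 {x} x≉0 xy≈0 =
    trans (ax+b≈0⇒x≈-a⁻¹b (proj₂ (inverse x x≉0)) (trans (+-identityʳ _) xy≈0)) (zeroʳ _)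

  [a+b]-[c+d]≈[a-c]+[b-d] : ∀ a b c d → (a + b) - (c + d) ≈ (a - c) + (b - d)
  [a+b]-[c+d]≈[a-c]+[b-d] a b c d = trans (+-congˡ (sym (⁻¹-∙-comm c d))) (interchange a b (- c) (- d))

  [a-b]-[c-d]≈[a-c]-[b-d] : ∀ a b c d → (a - b) - (c - d) ≈ (a - c) - (b - d)
  [a-b]-[c-d]≈[a-c]-[b-d] a b c d =
    trans ([a+b]-[c+d]≈[a-c]+[b-d] a (- b) c (- d)) (+-congˡ (⁻¹-∙-comm b (- d)))

  a-[a-c]≈c : ∀ a c → a - (a - c) ≈ c
  a-[a-c]≈c a c = begin
    a - (a - c)  ≈⟨ +-congˡ (⁻¹-anti-homo‿- a c) ⟩
    a + (c - a)  ≈⟨ +-assoc a c (- a) ⟨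
    a + c - a    ≈⟨ xyx⁻¹≈y a c ⟩
    c            ∎

  [a-[b-c]]+[b-[a-d]]≈c+d : ∀ a b c d → (a - (b - c)) + (b - (a - d)) ≈ c + d
  [a-[b-c]]+[b-[a-d]]≈c+d a b c d = begin
    (a - (b - c)) + (b - (a - d))  ≈⟨ +-cong (+-congˡ (⁻¹-anti-homo‿- b c))
                                              (+-congˡ (⁻¹-anti-homo‿- a d)) ⟩
    (a + (c - b)) + (b + (d - a))  ≈⟨ interchange a (c - b) b (d - a) ⟩
    (a + b) + ((c - b) + (d - a))  ≈⟨ +-congˡ ([a+b]-[c+d]≈[a-c]+[b-d] c d b a) ⟨
    (a + b) + ((c + d) - (b + a))  ≈⟨ +-congˡ (+-congˡ (-‿cong (+-comm b a))) ⟩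
    (a + b) + ((c + d) - (a + b))  ≈⟨ +-assoc (a + b) (c + d) _ ⟨
    (a + b) + (c + d) - (a + b)    ≈⟨ xyx⁻¹≈y (a + b) (c + d) ⟩
    c + d                          ∎

  Vector : Set i → Set (c ⊔ i)
  Vector I = I → Carrier

  infix 4 _≈ᶠ_
  infixl 6 _+ᶠ_ _-ᶠ_
  infixr 7 _·ᶠ_
  infix 8 -ᶠ_

  _≈ᶠ_ : {I : Set i} → Vector I → Vector I → Set (ℓ ⊔ i)
  x ≈ᶠ y = ∀ k → x k ≈ y k

  0ᶠ : Vector I
  0ᶠ _ = 0#

  _+ᶠ_ _-ᶠ_ : Vector I → Vector I → Vector I
  (x +ᶠ y) k = x k + y k
  (x -ᶠ y) k = x k - y k

  -ᶠ_ : Vector I → Vector I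
  (-ᶠ x) k = - x k

  _·ᶠ_ : Carrier → Vector I → Vector I
  (a ·ᶠ x) k = a * x k

  ≈ᶠ-refl : {x : Vector I} → x ≈ᶠ x
  ≈ᶠ-refl _ = refl

  ≈ᶠ-sym : {x y : Vector I} → x ≈ᶠ y → y ≈ᶠ x
  ≈ᶠ-sym x≈y k = sym (x≈y k)

  ≈ᶠ-trans : {x y z : Vector I} → x ≈ᶠ y → y ≈ᶠ z → x ≈ᶠ z
  ≈ᶠ-trans x≈y y≈z k = trans (x≈y k) (y≈z k)

  lincomb : List Carrier → List (Vector I) → Vector I
  lincomb [] _ = 0ᶠ
  lincomb (_ ∷ _) [] = 0ᶠ
  lincomb (a ∷ as) (x ∷ xs) = a ·ᶠ x +ᶠ lincomb as xs

  Dependent : {I : Set i} → List (Vector I) → Set (c ⊔ ℓ ⊔ i)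
  Dependent xs = ∃ λ as → length as ≡ length xs × lincomb as xs ≈ᶠ 0ᶠ × Any (_≉ 0#) as

  InSpan : {I : Set i} → List (Vector I) → Vector I → Set (c ⊔ ℓ ⊔ i)
  InSpan xs y = ∃ λ as → length as ≡ length xs × lincomb as xs ≈ᶠ y

  lincomb-++ : ∀ as bs (xs ys : List (Vector I)) → length as ≡ length xs →
    lincomb (as ++ bs) (xs ++ ys) ≈ᶠ lincomb as xs +ᶠ lincomb bs ys
  lincomb-++ [] bs [] ys _ k = sym (+-identityˡ _)
  lincomb-++ (a ∷ as) bs (x ∷ xs) ys len k =
    trans (+-congˡ (lincomb-++ as bs xs ys (ℕ.suc-injective len) k)) (sym (+-assoc _ _ _))

  lincomb-neg : ∀ as (xs : List (Vector I)) → lincomb (map -_ as) xs ≈ᶠ -ᶠ lincomb as xs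
  lincomb-neg [] xs k = sym ε⁻¹≈ε
  lincomb-neg (a ∷ as) [] k = sym ε⁻¹≈ε
  lincomb-neg (a ∷ as) (x ∷ xs) k = begin
    - a * x k + lincomb (map -_ as) xs k  ≈⟨ +-cong (sym (-‿distribˡ-* a (x k))) (lincomb-neg as xs k) ⟩
    - (a * x k) + - lincomb as xs k       ≈⟨ ⁻¹-∙-comm _ _ ⟩
    - (a * x k + lincomb as xs k)         ∎

  lincomb-scale : ∀ a as (xs : List (Vector I)) → lincomb (map (a *_) as) xs ≈ᶠ a ·ᶠ lincomb as xs
  lincomb-scale a [] xs k = sym (zeroʳ a)
  lincomb-scale a (b ∷ as) [] k = sym (zeroʳ a)
  lincomb-scale a (b ∷ as) (x ∷ xs) k =
    trans (+-cong (*-assoc a b (x k)) (lincomb-scale a as xs k)) (sym (distribˡ a _ _))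

  lincomb-zero-coeffs : ∀ as (xs : List (Vector I)) → All (_≈ 0#) as → lincomb as xs ≈ᶠ 0ᶠ
  lincomb-zero-coeffs [] xs _ k = refl
  lincomb-zero-coeffs (a ∷ as) [] _ k = refl
  lincomb-zero-coeffs (a ∷ as) (x ∷ xs) (a≈0 ∷ as≈0) k =
    trans (x≈0⇒xy+z≈z a≈0) (lincomb-zero-coeffs as xs as≈0 k)

  lincomb-zero-at : ∀ {k : I} as xs → All (λ x → x k ≈ 0#) xs → lincomb as xs k ≈ 0#
  lincomb-zero-at [] xs _ = refl
  lincomb-zero-at (a ∷ as) [] _ = refl
  lincomb-zero-at (a ∷ as) (x ∷ xs) (x≈0 ∷ xs≈0) =
    trans (+-cong (trans (*-congˡ x≈0) (zeroʳ a)) (lincomb-zero-at as xs xs≈0)) (+-identityʳ 0#)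

  lincomb-reindex : ∀ {j} {J : Set j} (f : J → I) as xs k →
    lincomb as (map (_∘ f) xs) k ≡ lincomb as xs (f k)
  lincomb-reindex f [] xs k = ≡.refl
  lincomb-reindex f (a ∷ as) [] k = ≡.refl
  lincomb-reindex f (a ∷ as) (x ∷ xs) k = ≡.cong (a * x (f k) +_) (lincomb-reindex f as xs k)

  ∋-lincomb : ∀ {p} (S : Subspace F n p) as xs → All (S ∋_) xs → S ∋ lincomb as xs
  ∋-lincomb S [] xs _ = ∋-zero S
  ∋-lincomb S (a ∷ as) [] _ = ∋-zero S
  ∋-lincomb S (a ∷ as) (x ∷ xs) (x∈S ∷ xs⊆S) = ∋-+ S (∋-· S a x∈S) (∋-lincomb S as xs xs⊆S)

  ¬dependent-[] : ¬ Dependent {I = I} []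
  ¬dependent-[] ([] , _ , _ , ())

  dependent-reindex : ∀ {j} {J : Set j} (f : J → I) (g : I → J) → (∀ k → f (g k) ≡ k) →
    ∀ xs → Dependent (map (_∘ f) xs) → Dependent xs
  dependent-reindex f g f∘g≗id xs (as , len , as≈0 , nz) =
    as , ≡.trans len (List.length-map _ xs) , as≈0′ , nz
    where
    as≈0′ : lincomb as xs ≈ᶠ 0ᶠ
    as≈0′ k = ≡.subst (λ k′ → lincomb as xs k′ ≈ 0#) (f∘g≗id k)
      (≡.subst (_≈ 0#) (lincomb-reindex f as xs (g k)) (as≈0 (g k)))

  dependent-tail⇒dependent : (xs : List (Vector (Fin (suc n)))) → All (λ x → head x ≈ 0#) xs →
    Dependent (map tail xs) → Dependent xs
  dependent-tail⇒dependent xs heads≈0 (as , len , as≈0 , nz) =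
    as , ≡.trans len (List.length-map tail xs) , as≈0′ , nz
    where
    as≈0′ : lincomb as xs ≈ᶠ 0ᶠ
    as≈0′ zero = lincomb-zero-at as xs heads≈0
    as≈0′ (suc k) = ≡.subst (_≈ 0#) (lincomb-reindex suc as xs k) (as≈0 k)

  dependent-move : ∀ xs (x : Vector I) ys → Dependent (x ∷ xs ++ ys) → Dependent (xs ++ x ∷ ys)
  dependent-move xs x ys (a ∷ as , len , as≈0 , nz)
    with split-++ xs ys as (≡.trans (ℕ.suc-injective len) (List.length-++ xs))
  ... | bs , cs , ≡.refl , len₁ , len₂ = bs ++ a ∷ cs , len′ , as≈0′ , nz′ nz
    where
    len′ : length (bs ++ a ∷ cs) ≡ length (xs ++ x ∷ ys)
    len′ = ≡.trans (List.length-++ bs)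
      (≡.trans (≡.cong₂ ℕ._+_ len₁ (≡.cong suc len₂)) (≡.sym (List.length-++ xs)))
    as≈0′ : lincomb (bs ++ a ∷ cs) (xs ++ x ∷ ys) ≈ᶠ 0ᶠ
    as≈0′ k = begin
      lincomb (bs ++ a ∷ cs) (xs ++ x ∷ ys) k          ≈⟨ lincomb-++ bs (a ∷ cs) xs (x ∷ ys) len₁ k ⟩
      lincomb bs xs k + (a * x k + lincomb cs ys k)    ≈⟨ x+[y+z]≈y+[x+z] _ _ _ ⟩
      a * x k + (lincomb bs xs k + lincomb cs ys k)    ≈⟨ +-congˡ (lincomb-++ bs cs xs ys len₁ k) ⟨
      a * x k + lincomb (bs ++ cs) (xs ++ ys) k        ≈⟨ as≈0 k ⟩
      0#                                               ∎
    nz′ : Any (_≉ 0#) (a ∷ bs ++ cs) → Any (_≉ 0#) (bs ++ a ∷ cs)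
    nz′ (here a≉0) = Any.++⁺ʳ bs (here a≉0)
    nz′ (there nz) with Any.++⁻ bs nz
    ... | inj₁ nz₁ = Any.++⁺ˡ nz₁
    ... | inj₂ nz₂ = Any.++⁺ʳ bs (there nz₂)

  dependent-shear : ∀ (x : Vector I) (e : Vector I → Carrier) rs →
    Dependent (map (λ r → r +ᶠ e r ·ᶠ x) rs) → Dependent (x ∷ rs)
  dependent-shear {I = I} x e rs (as , len , as≈0 , nz) =
    shear-coeff as rs ∷ as , ≡.cong suc (≡.trans len (List.length-map _ rs)) ,
    (λ k → trans (+-comm _ _) (trans (sym (lincomb-shear as rs k)) (as≈0 k))) , there nz
    where
    shear-coeff : List Carrier → List (Vector I) → Carrier
    shear-coeff (a ∷ as) (r ∷ rs) = a * e r + shear-coeff as rs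
    shear-coeff _ _ = 0#

    lincomb-shear : ∀ as rs →
      lincomb as (map (λ r → r +ᶠ e r ·ᶠ x) rs) ≈ᶠ lincomb as rs +ᶠ shear-coeff as rs ·ᶠ x
    lincomb-shear [] rs k = sym (trans (+-congˡ (zeroˡ _)) (+-identityʳ _))
    lincomb-shear (a ∷ as) [] k = sym (trans (+-congˡ (zeroˡ _)) (+-identityʳ _))
    lincomb-shear (a ∷ as) (r ∷ rs) k = begin
      a * (r k + e r * x k) + lincomb as (map _ rs) k                ≈⟨ +-congˡ (lincomb-shear as rs k) ⟩
      a * (r k + e r * x k) + (lincomb as rs k + σ * x k)
        ≈⟨ +-congʳ (trans (distribˡ a _ _) (+-congˡ (sym (*-assoc a _ _)))) ⟩
      (a * r k + a * e r * x k) + (lincomb as rs k + σ * x k)       ≈⟨ interchange _ _ _ _ ⟩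
      (a * r k + lincomb as rs k) + (a * e r * x k + σ * x k)       ≈⟨ +-congˡ (distribʳ (x k) _ _) ⟨
      (a * r k + lincomb as rs k) + (a * e r + σ) * x k             ∎
      where σ = shear-coeff as rs

  ++-independent : ∀ {p} {S T : Subspace F n p} {xs ys} → All (S ∋_) xs → All (T ∋_) ys →
    TrivialIntersection F S T → ¬ Dependent xs → ¬ Dependent ys → ¬ Dependent (ys ++ xs)
  ++-independent {S = S} {T} {xs} {ys} xs⊆S ys⊆T S∩T≈0 xs-indep ys-indep (as , len , as≈0 , nz)
    with split-++ ys xs as (≡.trans len (List.length-++ ys))
  ... | bs , cs , ≡.refl , len₁ , len₂ =
    [ (λ nz₁ → ys-indep (bs , len₁ , ys-part≈0 , nz₁))
    , (λ nz₂ → xs-indep (cs , len₂ , xs-part≈0 , nz₂))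
    ]′ (Any.++⁻ bs nz)
    where
    sum≈0 : ∀ k → lincomb bs ys k + lincomb cs xs k ≈ 0#
    sum≈0 k = trans (sym (lincomb-++ bs cs ys xs len₁ k)) (as≈0 k)

    xs-part∈T : T ∋ lincomb cs xs
    xs-part∈T = resp T (λ k → trans (-1*x≈-x _) (sym (x+y≈0⇒x≈-y (trans (+-comm _ _) (sum≈0 k)))))
      (∋-· T (- 1#) (∋-lincomb T bs ys ys⊆T))

    xs-part≈0 : lincomb cs xs ≈ᶠ 0ᶠ
    xs-part≈0 = S∩T≈0 _ (∋-lincomb S cs xs xs⊆S) xs-part∈T

    ys-part≈0 : lincomb bs ys ≈ᶠ 0ᶠ
    ys-part≈0 k = trans (sym (+-identityʳ _)) (trans (+-congˡ (sym (xs-part≈0 k))) (sum≈0 k))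

  common-span⇒¬¬dependent : ∀ {xs ys} {w : Vector I} →
    InSpan xs w → InSpan ys w → ¬ w ≈ᶠ 0ᶠ → ¬ ¬ Dependent (ys ++ xs)
  common-span⇒¬¬dependent {xs = xs} {ys} {w} (as , len-as , as≈w) (bs , len-bs , bs≈w) w≉0 =
    ¬¬-map dependent (¬¬-¬All⇒Any¬ as λ as≈0 →
      w≉0 (≈ᶠ-trans (≈ᶠ-sym as≈w) (lincomb-zero-coeffs as xs as≈0)))
    where
    dependent : Any (_≉ 0#) as → Dependent (ys ++ xs)
    dependent nz = bs ++ map -_ as , len , combination≈0 , Any.++⁺ʳ bs (Any.map⁺ (Any.map -x≉0 nz))
      where
      len : length (bs ++ map -_ as) ≡ length (ys ++ xs)
      len = ≡.trans (List.length-++ bs) (≡.trans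
        (≡.cong₂ ℕ._+_ len-bs (≡.trans (List.length-map -_ as) len-as))
        (≡.sym (List.length-++ ys)))
      combination≈0 : lincomb (bs ++ map -_ as) (ys ++ xs) ≈ᶠ 0ᶠ
      combination≈0 k = begin
        lincomb (bs ++ map -_ as) (ys ++ xs) k         ≈⟨ lincomb-++ bs (map -_ as) ys xs len-bs k ⟩
        lincomb bs ys k + lincomb (map -_ as) xs k
          ≈⟨ +-cong (bs≈w k) (trans (lincomb-neg as xs k) (-‿cong (as≈w k))) ⟩
        w k - w k                                      ≈⟨ -‿inverseʳ (w k) ⟩
        0#                                             ∎

  ¬¬-dependent-∷ : ∀ (x : Vector I) xs → Dependent (x ∷ xs) → ¬ ¬ (InSpan xs x ⊎ Dependent xs)
  ¬¬-dependent-∷ x xs (a ∷ as , len , as≈0 , nz) = ¬¬-excluded-middle >>= λ where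
    (no a≉0) → let a⁻¹ , aa⁻¹≈1 = inverse a a≉0 in
      return (inj₁ (map ((- a⁻¹) *_) as , ≡.trans (List.length-map _ as) (ℕ.suc-injective len) ,
        λ k → trans (lincomb-scale (- a⁻¹) as xs k) (sym (ax+b≈0⇒x≈-a⁻¹b aa⁻¹≈1 (as≈0 k)))))
    (yes a≈0) → case nz of λ where
      (here a≉0) → contradiction a≈0 a≉0
      (there nz′) → return (inj₂
        (as , ℕ.suc-injective len , (λ k → trans (sym (x≈0⇒xy+z≈z a≈0)) (as≈0 k)) , nz′))

  InSpan-here : ∀ (y : Vector I) xs → InSpan (y ∷ xs) y
  InSpan-here y xs = 1# ∷ map (λ _ → 0#) xs , ≡.cong suc (List.length-map _ xs) , λ k →
    trans (+-cong (*-identityˡ _) (lincomb-zero-coeffs _ xs zeros≈0 k)) (+-identityʳ _)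
    where
    zeros≈0 = All.map⁺ (All.universal (λ _ → refl) xs)

  InSpan-there : ∀ (y : Vector I) {xs z} → InSpan xs z → InSpan (y ∷ xs) z
  InSpan-there y (as , len , as≈z) = 0# ∷ as , ≡.cong suc len , λ k → trans (x≈0⇒xy+z≈z refl) (as≈z k)

  record Basis {i p} {I : Set i} (P : Vector I → Set p) (ws : List (Vector I)) :
    Set (c ⊔ ℓ ⊔ i ⊔ p) where
    field
      vectors : List (Vector I)
      ⊆P : All P vectors
      independent : ¬ Dependent vectors
      spans : All (InSpan vectors) ws

  ¬¬-basis : ∀ {p} {P : Vector I → Set p} ws → All P ws → ¬ ¬ Basis P ws
  ¬¬-basis [] [] = return record { vectors = [] ; ⊆P = [] ; independent = ¬dependent-[] ; spans = [] }
  ¬¬-basis (w ∷ ws) (w∈P ∷ ws⊆P) = ¬¬-basis ws ws⊆P >>= λ B → let open Basis B in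
    ¬¬-excluded-middle >>= λ where
      (no indep) → return record
        { vectors = w ∷ vectors ; ⊆P = w∈P ∷ ⊆P ; independent = indep
        ; spans = InSpan-here w vectors ∷ All.map (InSpan-there w) spans }
      (yes dep) → ¬¬-dependent-∷ w vectors dep >>= λ where
        (inj₁ w∈span) → return record
          { vectors = vectors ; ⊆P = ⊆P ; independent = independent ; spans = w∈span ∷ spans }
        (inj₂ dep′) → contradiction dep′ independent

  Λ : ℕ → Set c
  Λ n = Vector (Coord n)

  1Λ : Λ n
  1Λ {zero} tt = 1#
  1Λ {suc n} (inj₁ k) = 1Λ k
  1Λ {suc n} (inj₂ k) = 0#

  -- Writing v = v₀ e₀ + v′ and x = x₁ + e₀ ∧ x₂ (the inj₁ and inj₂ halves),
  -- v ∧ x = v′ ∧ x₁ + e₀ ∧ (v₀ x₁ − v′ ∧ x₂).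
  infixr 7 _∧_
  _∧_ : Vector (Fin n) → Λ n → Λ n
  _∧_ {zero} v x _ = 0#
  _∧_ {suc n} v x (inj₁ k) = (tail v ∧ x ∘ inj₁) k
  _∧_ {suc n} v x (inj₂ k) = head v * x (inj₁ k) - (tail v ∧ x ∘ inj₂) k

  ∧-cong : {u v : Vector (Fin n)} {x y : Λ n} → u ≈ᶠ v → x ≈ᶠ y → u ∧ x ≈ᶠ v ∧ y
  ∧-cong {zero} _ _ _ = refl
  ∧-cong {suc n} u≈v x≈y (inj₁ k) = ∧-cong (u≈v ∘ suc) (x≈y ∘ inj₁) k
  ∧-cong {suc n} u≈v x≈y (inj₂ k) =
    +-cong (*-cong (u≈v zero) (x≈y (inj₁ k))) (-‿cong (∧-cong (u≈v ∘ suc) (x≈y ∘ inj₂) k))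

  ∧-zeroˡ : (x : Λ n) → 0ᶠ ∧ x ≈ᶠ 0ᶠ
  ∧-zeroˡ {zero} x _ = refl
  ∧-zeroˡ {suc n} x (inj₁ k) = ∧-zeroˡ (x ∘ inj₁) k
  ∧-zeroˡ {suc n} x (inj₂ k) = x-y≈0 (zeroˡ _) (∧-zeroˡ (x ∘ inj₂) k)

  ∧-zeroʳ : (v : Vector (Fin n)) → v ∧ 0ᶠ ≈ᶠ 0ᶠ
  ∧-zeroʳ {zero} v _ = refl
  ∧-zeroʳ {suc n} v (inj₁ k) = ∧-zeroʳ (tail v) k
  ∧-zeroʳ {suc n} v (inj₂ k) = x-y≈0 (zeroʳ _) (∧-zeroʳ (tail v) k)

  ∧-distribˡ-+ : ∀ (v : Vector (Fin n)) x y → v ∧ (x +ᶠ y) ≈ᶠ v ∧ x +ᶠ v ∧ y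
  ∧-distribˡ-+ {zero} v x y _ = sym (+-identityʳ 0#)
  ∧-distribˡ-+ {suc n} v x y (inj₁ k) = ∧-distribˡ-+ (tail v) _ _ k
  ∧-distribˡ-+ {suc n} v x y (inj₂ k) = trans
    (+-cong (distribˡ (head v) _ _) (-‿cong (∧-distribˡ-+ (tail v) _ _ k)))
    ([a+b]-[c+d]≈[a-c]+[b-d] _ _ _ _)

  ∧-distribʳ-+ : ∀ (u v : Vector (Fin n)) x → (u +ᶠ v) ∧ x ≈ᶠ u ∧ x +ᶠ v ∧ x
  ∧-distribʳ-+ {zero} u v x _ = sym (+-identityʳ 0#)
  ∧-distribʳ-+ {suc n} u v x (inj₁ k) = ∧-distribʳ-+ (tail u) (tail v) _ k
  ∧-distribʳ-+ {suc n} u v x (inj₂ k) = trans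
    (+-cong (distribʳ (x (inj₁ k)) _ _) (-‿cong (∧-distribʳ-+ (tail u) (tail v) _ k)))
    ([a+b]-[c+d]≈[a-c]+[b-d] _ _ _ _)

  ∧-scaleˡ : ∀ a (v : Vector (Fin n)) x → (a ·ᶠ v) ∧ x ≈ᶠ a ·ᶠ (v ∧ x)
  ∧-scaleˡ {zero} a v x _ = sym (zeroʳ a)
  ∧-scaleˡ {suc n} a v x (inj₁ k) = ∧-scaleˡ a (tail v) _ k
  ∧-scaleˡ {suc n} a v x (inj₂ k) = trans
    (+-cong (*-assoc a _ _) (-‿cong (∧-scaleˡ a (tail v) _ k)))
    (sym (x[y-z]≈xy-xz a _ _))

  ∧-scaleʳ : ∀ (v : Vector (Fin n)) a x → v ∧ (a ·ᶠ x) ≈ᶠ a ·ᶠ (v ∧ x)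
  ∧-scaleʳ {zero} v a x _ = sym (zeroʳ a)
  ∧-scaleʳ {suc n} v a x (inj₁ k) = ∧-scaleʳ (tail v) a _ k
  ∧-scaleʳ {suc n} v a x (inj₂ k) = trans
    (+-cong (x[yz]≈y[xz] (head v) a _) (-‿cong (∧-scaleʳ (tail v) a _ k)))
    (sym (x[y-z]≈xy-xz a _ _))

  ∧-linearʳ : ∀ (v : Vector (Fin n)) a x y → v ∧ (a ·ᶠ x -ᶠ y) ≈ᶠ a ·ᶠ (v ∧ x) -ᶠ v ∧ y
  ∧-linearʳ {zero} v a x y _ = sym (x-y≈0 (zeroʳ a) refl)
  ∧-linearʳ {suc n} v a x y (inj₁ k) = ∧-linearʳ (tail v) a _ _ k
  ∧-linearʳ {suc n} v a x y (inj₂ k) = begin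
    h * (a * x₁ - y₁) - (tail v ∧ (a ·ᶠ x ∘ inj₂ -ᶠ y ∘ inj₂)) k
      ≈⟨ +-cong (x[y-z]≈xy-xz h _ _) (-‿cong (∧-linearʳ (tail v) a _ _ k)) ⟩
    (h * (a * x₁) - h * y₁) - (a * z - w)  ≈⟨ +-congʳ (+-congʳ (x[yz]≈y[xz] h a x₁)) ⟩
    (a * (h * x₁) - h * y₁) - (a * z - w)  ≈⟨ [a-b]-[c-d]≈[a-c]-[b-d] _ _ _ _ ⟩
    (a * (h * x₁) - a * z) - (h * y₁ - w)  ≈⟨ +-congʳ (x[y-z]≈xy-xz a _ _) ⟨
    a * (h * x₁ - z) - (h * y₁ - w)        ∎
    where
    h = head v
    x₁ = x (inj₁ k)
    y₁ = y (inj₁ k)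
    z = (tail v ∧ x ∘ inj₂) k
    w = (tail v ∧ y ∘ inj₂) k

  ∧-anticomm : ∀ (u v : Vector (Fin n)) x → u ∧ v ∧ x +ᶠ v ∧ u ∧ x ≈ᶠ 0ᶠ
  ∧-anticomm {zero} u v x _ = +-identityʳ 0#
  ∧-anticomm {suc n} u v x (inj₁ k) = ∧-anticomm (tail u) (tail v) _ k
  ∧-anticomm {suc n} u v x (inj₂ k) = begin
    (u ∧ v ∧ x) (inj₂ k) + (v ∧ u ∧ x) (inj₂ k)
      ≈⟨ +-cong (+-congˡ (-‿cong (∧-linearʳ (tail u) (head v) _ _ k)))
                (+-congˡ (-‿cong (∧-linearʳ (tail v) (head u) _ _ k))) ⟩
    (a - (b - (tail u ∧ tail v ∧ x ∘ inj₂) k)) + (b - (a - (tail v ∧ tail u ∧ x ∘ inj₂) k))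
      ≈⟨ [a-[b-c]]+[b-[a-d]]≈c+d _ _ _ _ ⟩
    (tail u ∧ tail v ∧ x ∘ inj₂) k + (tail v ∧ tail u ∧ x ∘ inj₂) k
      ≈⟨ ∧-anticomm (tail u) (tail v) _ k ⟩
    0# ∎
    where
    a = head u * (tail v ∧ x ∘ inj₁) k
    b = head v * (tail u ∧ x ∘ inj₁) k

  ∧-alternating : ∀ (v : Vector (Fin n)) x → v ∧ v ∧ x ≈ᶠ 0ᶠ
  ∧-alternating {zero} v x _ = refl
  ∧-alternating {suc n} v x (inj₁ k) = ∧-alternating (tail v) _ k
  ∧-alternating {suc n} v x (inj₂ k) = begin
    (v ∧ v ∧ x) (inj₂ k)                        ≈⟨ +-congˡ (-‿cong (∧-linearʳ (tail v) (head v) _ _ k)) ⟩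
    a - (a - (tail v ∧ tail v ∧ x ∘ inj₂) k)    ≈⟨ a-[a-c]≈c _ _ ⟩
    (tail v ∧ tail v ∧ x ∘ inj₂) k              ≈⟨ ∧-alternating (tail v) _ k ⟩
    0#                                          ∎
    where
    a = head v * (tail v ∧ x ∘ inj₁) k

  ∧-swap : ∀ (u v : Vector (Fin n)) x → u ∧ v ∧ x ≈ᶠ -ᶠ (v ∧ u ∧ x)
  ∧-swap u v x k = x+y≈0⇒x≈-y (∧-anticomm u v x k)

  infixr 7 _∧*_
  _∧*_ : List (Vector (Fin n)) → Λ n → Λ n
  [] ∧* x = x
  (v ∷ vs) ∧* x = v ∧ vs ∧* x

  ⋀ : List (Vector (Fin n)) → Λ n
  ⋀ vs = vs ∧* 1Λ

  ∧*-++ : ∀ (vs ws : List (Vector (Fin n))) x → (vs ++ ws) ∧* x ≡ vs ∧* ws ∧* x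
  ∧*-++ [] ws x = ≡.refl
  ∧*-++ (v ∷ vs) ws x = ≡.cong (v ∧_) (∧*-++ vs ws x)

  ∧*-cong : ∀ (vs : List (Vector (Fin n))) {x y} → x ≈ᶠ y → vs ∧* x ≈ᶠ vs ∧* y
  ∧*-cong [] x≈y = x≈y
  ∧*-cong (v ∷ vs) x≈y = ∧-cong ≈ᶠ-refl (∧*-cong vs x≈y)

  ∧*-zeroʳ : ∀ (vs : List (Vector (Fin n))) → vs ∧* 0ᶠ ≈ᶠ 0ᶠ
  ∧*-zeroʳ [] = ≈ᶠ-refl
  ∧*-zeroʳ (v ∷ vs) = ≈ᶠ-trans (∧-cong ≈ᶠ-refl (∧*-zeroʳ vs)) (∧-zeroʳ v)

  ∧*-distribˡ-+ : ∀ (vs : List (Vector (Fin n))) x y → vs ∧* (x +ᶠ y) ≈ᶠ vs ∧* x +ᶠ vs ∧* y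
  ∧*-distribˡ-+ [] x y = ≈ᶠ-refl
  ∧*-distribˡ-+ (v ∷ vs) x y = ≈ᶠ-trans (∧-cong ≈ᶠ-refl (∧*-distribˡ-+ vs x y)) (∧-distribˡ-+ v _ _)

  ∧*-scaleʳ : ∀ (vs : List (Vector (Fin n))) a x → vs ∧* (a ·ᶠ x) ≈ᶠ a ·ᶠ (vs ∧* x)
  ∧*-scaleʳ [] a x = ≈ᶠ-refl
  ∧*-scaleʳ (v ∷ vs) a x = ≈ᶠ-trans (∧-cong ≈ᶠ-refl (∧*-scaleʳ vs a x)) (∧-scaleʳ v a _)

  ∧-∧*-repeated : ∀ {v : Vector (Fin n)} vs w → v ∈ vs → v ∧ vs ∧* w ≈ᶠ 0ᶠ
  ∧-∧*-repeated (u ∷ vs) w (here ≡.refl) = ∧-alternating u (vs ∧* w)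
  ∧-∧*-repeated {v = v} (u ∷ vs) w (there v∈vs) k = trans (∧-swap v u _ k)
    (-x≈0 (≈ᶠ-trans (∧-cong ≈ᶠ-refl (∧-∧*-repeated vs w v∈vs)) (∧-zeroʳ u) k))

  sign : List A → Carrier
  sign [] = 1#
  sign (_ ∷ xs) = - sign xs

  ∧-∧*-comm : ∀ (v : Vector (Fin n)) us w → v ∧ us ∧* w ≈ᶠ sign us ·ᶠ (us ∧* v ∧ w)
  ∧-∧*-comm v [] w k = sym (*-identityˡ _)
  ∧-∧*-comm v (u ∷ us) w k = begin
    (v ∧ u ∧ us ∧* w) k                      ≈⟨ ∧-swap v u _ k ⟩
    - (u ∧ v ∧ us ∧* w) k                    ≈⟨ -‿cong (∧-cong ≈ᶠ-refl (∧-∧*-comm v us w) k) ⟩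
    - (u ∧ sign us ·ᶠ (us ∧* v ∧ w)) k       ≈⟨ -‿cong (∧-scaleʳ u (sign us) _ k) ⟩
    - (sign us * (u ∧ us ∧* v ∧ w) k)        ≈⟨ -‿distribˡ-* _ _ ⟩
    - sign us * (u ∧ us ∧* v ∧ w) k          ∎

  ⋀-move : ∀ us (v : Vector (Fin n)) ws → ⋀ (us ++ v ∷ ws) ≈ᶠ 0ᶠ → ⋀ (v ∷ us ++ ws) ≈ᶠ 0ᶠ
  ⋀-move us v ws ⋀≈0 k = begin
    (v ∧ (us ++ ws) ∧* 1Λ) k             ≡⟨ ≡.cong (λ x → (v ∧ x) k) (∧*-++ us ws 1Λ) ⟩
    (v ∧ us ∧* ⋀ ws) k                   ≈⟨ ∧-∧*-comm v us (⋀ ws) k ⟩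
    sign us * (us ∧* v ∧ ⋀ ws) k         ≡⟨ ≡.cong (λ x → sign us * x k) (∧*-++ us (v ∷ ws) 1Λ) ⟨
    sign us * ⋀ (us ++ v ∷ ws) k         ≈⟨ *-congˡ (⋀≈0 k) ⟩
    sign us * 0#                         ≈⟨ zeroʳ _ ⟩
    0#                                   ∎

  Homogeneous : ℕ → Λ n → Set ℓ
  Homogeneous k x = ∀ c → size c ≢ k → x c ≈ 0#

  1Λ-homogeneous : Homogeneous {n} 0 1Λ
  1Λ-homogeneous {zero} tt 0≢0 = contradiction ≡.refl 0≢0
  1Λ-homogeneous {suc n} (inj₁ c) size≢0 = 1Λ-homogeneous c size≢0
  1Λ-homogeneous {suc n} (inj₂ c) _ = refl

  ∧-homogeneous : ∀ {k} (v : Vector (Fin n)) {x} → Homogeneous k x → Homogeneous (suc k) (v ∧ x)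
  ∧-homogeneous {zero} v x-hom tt _ = refl
  ∧-homogeneous {suc n} v x-hom (inj₁ c) size≢ = ∧-homogeneous (tail v) (x-hom ∘ inj₁) c size≢
  ∧-homogeneous {suc n} {zero} v {x} x-hom (inj₂ c) size≢ = x-y≈0
    (trans (*-congˡ (x-hom (inj₁ c) (size≢ ∘ ≡.cong suc))) (zeroʳ _))
    (≈ᶠ-trans (∧-cong ≈ᶠ-refl (λ c′ → x-hom (inj₂ c′) λ ())) (∧-zeroʳ (tail v)) c)
  ∧-homogeneous {suc n} {suc k} v {x} x-hom (inj₂ c) size≢ = x-y≈0
    (trans (*-congˡ (x-hom (inj₁ c) (size≢ ∘ ≡.cong suc))) (zeroʳ _))
    (∧-homogeneous (tail v) (λ c′ ≢k → x-hom (inj₂ c′) (≢k ∘ ℕ.suc-injective)) c (size≢ ∘ ≡.cong suc))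

  ⋀-homogeneous : ∀ (vs : List (Vector (Fin n))) → Homogeneous (length vs) (⋀ vs)
  ⋀-homogeneous [] = 1Λ-homogeneous
  ⋀-homogeneous (v ∷ vs) = ∧-homogeneous v (⋀-homogeneous vs)

  ⋀-long≈0 : ∀ (vs : List (Vector (Fin n))) → n ℕ.< length vs → ⋀ vs ≈ᶠ 0ᶠ
  ⋀-long≈0 vs n<len c = ⋀-homogeneous vs c (ℕ.<⇒≢ (ℕ.≤-<-trans (size≤n c) n<len))

  lincomb-∧≈0 : ∀ (w : Λ n) as xs → All (λ x → x ∧ w ≈ᶠ 0ᶠ) xs → lincomb as xs ∧ w ≈ᶠ 0ᶠ
  lincomb-∧≈0 w [] xs _ = ∧-zeroˡ w
  lincomb-∧≈0 w (a ∷ as) [] _ = ∧-zeroˡ w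
  lincomb-∧≈0 w (a ∷ as) (x ∷ xs) (x∧w≈0 ∷ xs∧w≈0) k = begin
    ((a ·ᶠ x +ᶠ lincomb as xs) ∧ w) k           ≈⟨ ∧-distribʳ-+ _ _ w k ⟩
    ((a ·ᶠ x) ∧ w) k + (lincomb as xs ∧ w) k
      ≈⟨ +-cong (∧-scaleˡ a x w k) (lincomb-∧≈0 w as xs xs∧w≈0 k) ⟩
    a * (x ∧ w) k + 0#                          ≈⟨ x≈0⇒x+y≈y (trans (*-congˡ (x∧w≈0 k)) (zeroʳ a)) ⟩
    0#                                          ∎

  InSpan⇒∧-∧*≈0 : ∀ {xs} {y : Vector (Fin n)} w → InSpan xs y → y ∧ xs ∧* w ≈ᶠ 0ᶠ
  InSpan⇒∧-∧*≈0 {xs = xs} w (as , _ , as≈y) = ≈ᶠ-trans (∧-cong (≈ᶠ-sym as≈y) ≈ᶠ-refl)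
    (lincomb-∧≈0 _ as xs (All.tabulate λ x∈xs → ∧-∧*-repeated xs w x∈xs))

  dependent⇒¬¬⋀≈0 : ∀ (xs : List (Vector (Fin n))) → Dependent xs → ¬ ¬ ⋀ xs ≈ᶠ 0ᶠ
  dependent⇒¬¬⋀≈0 [] dep = contradiction dep ¬dependent-[]
  dependent⇒¬¬⋀≈0 (x ∷ xs) dep = ¬¬-dependent-∷ x xs dep >>= λ where
    (inj₁ x∈span) → return (InSpan⇒∧-∧*≈0 1Λ x∈span)
    (inj₂ dep′) → ¬¬-map (λ ⋀xs≈0 → ≈ᶠ-trans (∧-cong ≈ᶠ-refl ⋀xs≈0) (∧-zeroʳ x))
      (dependent⇒¬¬⋀≈0 xs dep′)

  ⋀-heads≈0 : ∀ (xs : List (Vector (Fin (suc n)))) → All (λ x → head x ≈ 0#) xs →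
    ⋀ xs ∘ inj₁ ≈ᶠ ⋀ (map tail xs) × ⋀ xs ∘ inj₂ ≈ᶠ 0ᶠ
  ⋀-heads≈0 [] [] = ≈ᶠ-refl , ≈ᶠ-refl
  ⋀-heads≈0 (x ∷ xs) (x₀≈0 ∷ heads≈0) =
    let ⋀₁ , ⋀₂ = ⋀-heads≈0 xs heads≈0 in
    ∧-cong ≈ᶠ-refl ⋀₁ ,
    λ k → x-y≈0 (trans (*-congʳ x₀≈0) (zeroˡ _)) (≈ᶠ-trans (∧-cong ≈ᶠ-refl ⋀₂) (∧-zeroʳ (tail x)) k)

  ∧-⋀-shear : ∀ (x : Vector (Fin n)) (e : Vector (Fin n) → Carrier) rs →
    x ∧ ⋀ (map (λ r → r +ᶠ e r ·ᶠ x) rs) ≈ᶠ x ∧ ⋀ rs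
  ∧-⋀-shear x e [] = ≈ᶠ-refl
  ∧-⋀-shear x e (r ∷ rs) k = begin
    (x ∧ (r +ᶠ e r ·ᶠ x) ∧ W) k
      ≈⟨ ∧-cong ≈ᶠ-refl (≈ᶠ-trans (∧-distribʳ-+ r _ W) (λ j → +-congˡ (∧-scaleˡ (e r) x W j))) k ⟩
    (x ∧ (r ∧ W +ᶠ e r ·ᶠ (x ∧ W))) k            ≈⟨ ∧-distribˡ-+ x _ _ k ⟩
    (x ∧ r ∧ W) k + (x ∧ e r ·ᶠ (x ∧ W)) k
      ≈⟨ +-congˡ (trans (∧-scaleʳ x (e r) _ k) (*-congˡ (∧-alternating x W k))) ⟩
    (x ∧ r ∧ W) k + e r * 0#                     ≈⟨ trans (+-congˡ (zeroʳ _)) (+-identityʳ _) ⟩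
    (x ∧ r ∧ W) k                                ≈⟨ ∧-swap x r W k ⟩
    - (r ∧ x ∧ W) k                              ≈⟨ -‿cong (∧-cong ≈ᶠ-refl (∧-⋀-shear x e rs) k) ⟩
    - (r ∧ x ∧ ⋀ rs) k                           ≈⟨ ∧-swap x r (⋀ rs) k ⟨
    (x ∧ r ∧ ⋀ rs) k                             ∎
    where
    W = ⋀ (map (λ r → r +ᶠ e r ·ᶠ x) rs)

  dependent-Fin0 : ∀ (x : Vector (Fin 0)) xs → Dependent (x ∷ xs)
  dependent-Fin0 x xs =
    1# ∷ map (λ _ → 0#) xs , ≡.cong suc (List.length-map _ xs) , (λ ()) , here (0≉1 ∘ sym)

  -- Subtracting multiples of x clears the first coordinate of the other vectors without
  -- changing x ∧ ⋀ rs; the e₀-part of the result is then x₀ times a wedge in dimension n.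
  ⋀≈0⇒¬¬dependent-pivot : (∀ (ys : List (Vector (Fin n))) → ⋀ ys ≈ᶠ 0ᶠ → ¬ ¬ Dependent ys) →
    ∀ (x : Vector (Fin (suc n))) rs → head x ≉ 0# → ⋀ (x ∷ rs) ≈ᶠ 0ᶠ → ¬ ¬ Dependent (x ∷ rs)
  ⋀≈0⇒¬¬dependent-pivot {n} ih x rs x₀≉0 ⋀≈0 =
    ¬¬-map (dependent-shear x e rs ∘ dependent-tail⇒dependent rs′ heads≈0) (ih (map tail rs′) ⋀tails≈0)
    where
    x₀⁻¹ = proj₁ (inverse (head x) x₀≉0)
    x₀x₀⁻¹≈1 = proj₂ (inverse (head x) x₀≉0)

    e : Vector (Fin (suc n)) → Carrier
    e r = - (head r * x₀⁻¹)

    rs′ = map (λ r → r +ᶠ e r ·ᶠ x) rs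

    head-cleared : ∀ r → head (r +ᶠ e r ·ᶠ x) ≈ 0#
    head-cleared r = begin
      head r + - (head r * x₀⁻¹) * head x   ≈⟨ +-congˡ (sym (-‿distribˡ-* _ _)) ⟩
      head r - head r * x₀⁻¹ * head x       ≈⟨ +-congˡ (-‿cong (*-assoc _ _ _)) ⟩
      head r - head r * (x₀⁻¹ * head x)     ≈⟨ +-congˡ (-‿cong (*-congˡ (trans (*-comm _ _) x₀x₀⁻¹≈1))) ⟩
      head r - head r * 1#                  ≈⟨ +-congˡ (-‿cong (*-identityʳ _)) ⟩
      head r - head r                       ≈⟨ -‿inverseʳ _ ⟩
      0#                                    ∎

    heads≈0 : All (λ r → head r ≈ 0#) rs′
    heads≈0 = All.map⁺ (All.universal head-cleared rs)

    ⋀tails≈0 : ⋀ (map tail rs′) ≈ᶠ 0ᶠ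
    ⋀tails≈0 k = xy≈0⇒y≈0 x₀≉0 (begin
      head x * ⋀ (map tail rs′) k     ≈⟨ *-congˡ (proj₁ ⋀rs′ k) ⟨
      head x * ⋀ rs′ (inj₁ k)         ≈⟨ x-0≈x ⟨
      head x * ⋀ rs′ (inj₁ k) - 0#
        ≈⟨ +-congˡ (-‿cong (≈ᶠ-trans (∧-cong ≈ᶠ-refl (proj₂ ⋀rs′)) (∧-zeroʳ (tail x)) k)) ⟨
      (x ∧ ⋀ rs′) (inj₂ k)            ≈⟨ ∧-⋀-shear x e rs (inj₂ k) ⟩
      ⋀ (x ∷ rs) (inj₂ k)             ≈⟨ ⋀≈0 (inj₂ k) ⟩
      0#                              ∎)
      where
      ⋀rs′ = ⋀-heads≈0 rs′ heads≈0

  ⋀≈0⇒¬¬dependent : ∀ (xs : List (Vector (Fin n))) → ⋀ xs ≈ᶠ 0ᶠ → ¬ ¬ Dependent xs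
  ⋀≈0⇒¬¬dependent {zero} [] ⋀≈0 = contradiction (sym (⋀≈0 tt)) 0≉1
  ⋀≈0⇒¬¬dependent {zero} (x ∷ xs) _ = return (dependent-Fin0 x xs)
  ⋀≈0⇒¬¬dependent {suc n} xs ⋀≈0 = ¬¬-excluded-middle >>= by-heads
    where
    by-heads : Dec (All (λ x → head x ≈ 0#) xs) → ¬ ¬ Dependent xs
    by-heads (yes heads≈0) = ¬¬-map (dependent-tail⇒dependent xs heads≈0)
      (⋀≈0⇒¬¬dependent (map tail xs) λ k → trans (sym (proj₁ (⋀-heads≈0 xs heads≈0) k)) (⋀≈0 (inj₁ k)))
    by-heads (no ¬heads≈0) = ¬¬-¬All⇒split xs ¬heads≈0 >>= λ (ys , zs , x , xs≡ , x₀≉0) →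
      ¬¬-map (≡.subst Dependent (≡.sym xs≡) ∘ dependent-move ys x zs)
        (⋀≈0⇒¬¬dependent-pivot ⋀≈0⇒¬¬dependent x (ys ++ zs) x₀≉0
          (⋀-move ys x zs (≡.subst (λ l → ⋀ l ≈ᶠ 0ᶠ) xs≡ ⋀≈0)))

  ¬¬-nonzero-coordinate : (x : Λ n) → ¬ x ≈ᶠ 0ᶠ → ¬ ¬ ∃ λ c → x c ≉ 0#
  ¬¬-nonzero-coordinate {n} x x≉0 ¬∃ =
    ¬¬-pull-Fin (λ i x≉0-at → ¬∃ (decode n i , x≉0-at)) λ x∘decode≈0 →
      x≉0 λ c → ≡.subst (λ c′ → x c′ ≈ 0#) (decode-encode n c) (x∘decode≈0 (encode n c))

  -- Λ n ≅ F^(2^n) through its coordinates, and in F^k any k + 1 vectors have vanishing ⋀.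
  independent⇒length≤2^n : (xs : List (Λ n)) → ¬ Dependent xs → length xs ≤ 2 ^ n
  independent⇒length≤2^n {n} xs indep = decidable-stable (length xs ℕ.≤? 2 ^ n) λ len≰ →
    ⋀≈0⇒¬¬dependent ys (⋀-long≈0 ys (≡.subst (2 ^ n ℕ.<_) (≡.sym (List.length-map _ xs)) (ℕ.≰⇒> len≰)))
      (indep ∘ dependent-reindex (decode n) (encode n) (decode-encode n) xs)
    where
    ys = map (_∘ decode n) xs

  record IsLinearForm {i} {I : Set i} (φ : Vector I → Carrier) : Set (c ⊔ ℓ ⊔ i) where
    field
      cong : ∀ {x y} → x ≈ᶠ y → φ x ≈ φ y
      zero-homo : φ 0ᶠ ≈ 0#
      linear : ∀ a x y → φ (a ·ᶠ x +ᶠ y) ≈ a * φ x + φ y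

  open IsLinearForm

  ∧*-isLinearForm : ∀ (vs : List (Vector (Fin n))) c → IsLinearForm (λ x → (vs ∧* x) c)
  ∧*-isLinearForm vs c = record
    { cong = λ x≈y → ∧*-cong vs x≈y c
    ; zero-homo = ∧*-zeroʳ vs c
    ; linear = λ a x y → trans (∧*-distribˡ-+ vs _ _ c) (+-congʳ (∧*-scaleʳ vs a x c))
    }

  triangular-coeffs≈0 : ∀ {m} (φ : Fin m → Vector I → Carrier) (p : Fin m → Vector I) →
    (∀ i → IsLinearForm (φ i)) → (∀ i → φ i (p i) ≉ 0#) → (∀ i j → i < j → φ j (p i) ≈ 0#) →
    ∀ as → length as ≡ m → (∀ j → φ j (lincomb as (tabulate p)) ≈ 0#) → All (_≈ 0#) as
  triangular-coeffs≈0 {m = zero} _ _ _ _ _ [] _ _ = []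
  triangular-coeffs≈0 {m = suc m} φ p lin diag upper (a ∷ as) len φ≈0 = a≈0 ∷ as≈0
    where
    rest = lincomb as (tabulate (p ∘ suc))

    φ-split : ∀ j → a * φ j (p zero) + φ j rest ≈ 0#
    φ-split j = trans (sym (linear (lin j) a (p zero) rest)) (φ≈0 j)

    as≈0 : All (_≈ 0#) as
    as≈0 = triangular-coeffs≈0 (φ ∘ suc) (p ∘ suc) (lin ∘ suc) (diag ∘ suc)
      (λ i j i<j → upper (suc i) (suc j) (ℕ.s≤s i<j)) as (ℕ.suc-injective len)
      λ j → trans (sym (x≈0⇒x+y≈y (trans (*-congˡ (upper zero (suc j) (ℕ.s≤s ℕ.z≤n))) (zeroʳ a))))
                  (φ-split (suc j))

    a≈0 : a ≈ 0#
    a≈0 = xy≈0⇒y≈0 (diag zero) (trans (*-comm _ _) (begin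
      a * φ zero (p zero)                    ≈⟨ +-identityʳ _ ⟨
      a * φ zero (p zero) + 0#
        ≈⟨ +-congˡ (trans (cong (lin zero) (lincomb-zero-coeffs as _ as≈0)) (zero-homo (lin zero))) ⟨
      a * φ zero (p zero) + φ zero rest      ≈⟨ φ-split zero ⟩
      0#                                     ∎))

  triangular⇒independent : ∀ {m} (φ : Fin m → Vector I → Carrier) (p : Fin m → Vector I) →
    (∀ i → IsLinearForm (φ i)) → (∀ i → φ i (p i) ≉ 0#) → (∀ i j → i < j → φ j (p i) ≈ 0#) →
    ¬ Dependent (tabulate p)
  triangular⇒independent φ p lin diag upper (as , len , as≈0 , nz) =
    Any¬⇒¬All nz (triangular-coeffs≈0 φ p lin diag upper as (≡.trans len (List.length-tabulate p))
      λ j → trans (cong (lin j) as≈0) (zero-homo (lin j)))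

  module SubspacePairs {n m p} (U V : Fin m → Subspace F n p)
    (U∩V≈0 : ∀ i → TrivialIntersection F (U i) (V i))
    (U∩V≉0 : ∀ i j → i < j → NontrivialIntersection F (U i) (V j)) where

    witness : Fin m → Fin m → Vector (Fin n)
    witness i j with i Fin.<? j
    ... | yes i<j = proj₁ (U∩V≉0 i j i<j)
    ... | no _ = 0ᶠ

    witness∈U : ∀ i j → U i ∋ witness i j
    witness∈U i j with i Fin.<? j
    ... | yes i<j = proj₁ (proj₂ (U∩V≉0 i j i<j))
    ... | no _ = ∋-zero (U i)

    witness∈V : ∀ i j → V j ∋ witness i j
    witness∈V i j with i Fin.<? j
    ... | yes i<j = proj₁ (proj₂ (proj₂ (U∩V≉0 i j i<j)))
    ... | no _ = ∋-zero (V j)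

    witness≉0 : ∀ {i j} → i < j → ¬ witness i j ≈ᶠ 0ᶠ
    witness≉0 {i} {j} i<j with i Fin.<? j
    ... | yes i<j′ = proj₂ (proj₂ (proj₂ (U∩V≉0 i j i<j′)))
    ... | no i≮j = contradiction i<j i≮j

    module _ (A : ∀ i → Basis (U i ∋_) (tabulate (witness i)))
             (B : ∀ j → Basis (V j ∋_) (tabulate (λ i → witness i j))) where

      open Basis

      α β : Fin m → List (Vector (Fin n))
      α i = vectors (A i)
      β j = vectors (B j)

      ⋀βα≉0 : ∀ i → ¬ ⋀ (β i ++ α i) ≈ᶠ 0ᶠ
      ⋀βα≉0 i ⋀≈0 = ⋀≈0⇒¬¬dependent _ ⋀≈0
        (++-independent {S = U i} {V i} (⊆P (A i)) (⊆P (B i)) (U∩V≈0 i)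
          (independent (A i)) (independent (B i)))

      ¬¬⋀βα≈0 : ∀ {i j} → i < j → ¬ ¬ ⋀ (β j ++ α i) ≈ᶠ 0ᶠ
      ¬¬⋀βα≈0 {i} {j} i<j =
        common-span⇒¬¬dependent (tabulate⁻ (spans (A i)) j) (tabulate⁻ (spans (B j)) i) (witness≉0 i<j)
          >>= dependent⇒¬¬⋀≈0 _

      ψ : Fin m → Λ n
      ψ i = ⋀ (α i)

      module _ (coord : Fin m → Coord n) (coord≉0 : ∀ j → ⋀ (β j ++ α j) (coord j) ≉ 0#) where

        φ : Fin m → Λ n → Carrier
        φ j x = (β j ∧* x) (coord j)

        φψ-diagonal : ∀ i → φ i (ψ i) ≉ 0#
        φψ-diagonal i = ≡.subst (λ x → x (coord i) ≉ 0#) (∧*-++ (β i) (α i) 1Λ) (coord≉0 i)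

        ¬¬φψ-upper : ∀ i j → i < j → ¬ ¬ φ j (ψ i) ≈ 0#
        ¬¬φψ-upper i j i<j = ¬¬-map
          (λ ⋀≈0 → ≡.subst (λ x → x (coord j) ≈ 0#) (∧*-++ (β j) (α i) 1Λ) (⋀≈0 (coord j)))
          (¬¬⋀βα≈0 i<j)

        ¬¬ψ-independent : ¬ ¬ ¬ Dependent (tabulate ψ)
        ¬¬ψ-independent = ¬¬-pull-Fin (λ i → ¬¬-pull-Fin λ j → ¬¬-pull-→ (¬¬φψ-upper i j)) >>= λ upper →
          return (triangular⇒independent φ ψ (λ j → ∧*-isLinearForm (β j) (coord j)) φψ-diagonal upper)

      ψ-independent : ¬ Dependent (tabulate ψ)
      ψ-independent = negated-stable (
        ¬¬-pull-Fin (λ j → ¬¬-nonzero-coordinate _ (⋀βα≉0 j)) >>= λ nonzero →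
        ¬¬ψ-independent (proj₁ ∘ nonzero) (proj₂ ∘ nonzero))

lemma3 : ∀ {c ℓ p} (F : Field c ℓ) (n m : ℕ) (U V : Fin m → Subspace F n p) → (∀ i → TrivialIntersection F (U i) (V i)) → (∀ i j → i < j → NontrivialIntersection F (U i) (V j)) → m ≤ 2 ^ n
lemma3 F n m U V U∩V≈0 U∩V≉0 = decidable-stable (m ℕ.≤? 2 ^ n) (
  ¬¬-pull-Fin (λ i → ¬¬-basis _ (tabulate⁺ (witness∈U i))) >>= λ A →
  ¬¬-pull-Fin (λ j → ¬¬-basis _ (tabulate⁺ (λ i → witness∈V i j))) >>= λ B →
  return (≡.subst (_≤ 2 ^ n) (List.length-tabulate (ψ A B))
    (independent⇒length≤2^n _ (ψ-independent A B))))
  where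
  open LinearAlgebra F
  open SubspacePairs U V U∩V≈0 U∩V≉0
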